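{- Let $P(5,1)$ be the graph with vertex set $\{u_0,\dots,u_4,v_0,\dots,v_4\}$ and edges $u_iu_{i+1}$, $v_iv_{i+1}$, $u_iv_i$ ($i=0,\dots,4$, indices mod $5$). The number of distinct automorphic types of matchings of $P(5,1)$ of size two is eight.
   Context: A matching of size $k$ is a set of $k$ pairwise vertex-disjoint edges. Two matchings $M_1,M_2$ of a graph $G$ are automorphic (of the same automorphic type) if there is an automorphism $f$ of $G$ with $uv\in M_1$ iff $f(u)f(v)\in M_2$; the number of distinct automorphic types of matchings of size $k$ is the number of orbits of the automorphism group of $G$ on the set of matchings of size $k$. -}

module Defs where

open import Data.Nat using (ℕ)
open import Data.Fin using (Fin; zero; suc)
open import Data.Product using (Σ; ∃; _×_; _,_; proj₁; proj₂)
open import Data.Sum using (_⊎_)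
open import Relation.Binary.PropositionalEquality using (_≡_; _≢_)
open import Function.Bundles using (_↔_; _⇔_; Inverse)

data V : Set where
  u : Fin 5 → V
  v : Fin 5 → V

next : Fin 5 → Fin 5
next zero = suc zero
next (suc zero) = suc (suc zero)
next (suc (suc zero)) = suc (suc (suc zero))
next (suc (suc (suc zero))) = suc (suc (suc (suc zero)))
next (suc (suc (suc (suc zero)))) = zero

data Adj : V → V → Set where
  uu  : ∀ i → Adj (u i) (u (next i))
  uu' : ∀ i → Adj (u (next i)) (u i)
  vv  : ∀ i → Adj (v i) (v (next i))
  vv' : ∀ i → Adj (v (next i)) (v i)
  uv  : ∀ i → Adj (u i) (v i)
  vu  : ∀ i → Adj (v i) (u i)

record Automorphism : Set where
  field
    perm    : V ↔ V
    preserv : ∀ x y → Adj x y ⇔ Adj (Inverse.to perm x) (Inverse.to perm y)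

record Matching (k : ℕ) : Set where
  field
    edge     : Fin k → V × V
    isEdge   : ∀ i → Adj (proj₁ (edge i)) (proj₂ (edge i))
    disjoint : ∀ i j → i ≢ j →
      (proj₁ (edge i) ≢ proj₁ (edge j)) × (proj₁ (edge i) ≢ proj₂ (edge j)) ×
      (proj₂ (edge i) ≢ proj₁ (edge j)) × (proj₂ (edge i) ≢ proj₂ (edge j))

_─_∈_ : ∀ {k} → V → V → Matching k → Set
x ─ y ∈ M = ∃ λ i → (Matching.edge M i ≡ (x , y)) ⊎ (Matching.edge M i ≡ (y , x))

Automorphic : ∀ {k} → Matching k → Matching k → Set
Automorphic M₁ M₂ = ∃ λ (f : Automorphism) → ∀ x y →
  (x ─ y ∈ M₁) ⇔ (Inverse.to (Automorphism.perm f) x ─ Inverse.to (Automorphism.perm f) y ∈ M₂)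

-- Automorphisms preserve spokes, since these are exactly the edges of P(5,1) lying on no 5-cycle.
-- So for a 2-matching the number of its spokes, the number of edges joining its two edges, and the
-- number of spokes among those joining edges are automorphism invariants; they take eight values.
-- Conversely, an exhaustive search over the twenty symmetries generated by a rotation, a reflection
-- and the exchange of the two pentagons carries every 2-matching onto one of eight representatives,
-- one for each value of the invariant.
module Submission where

open import Defs
open import Data.Fin using (Fin)
open import Data.Product using (Σ; ∃; _×_)
open import Relation.Binary.PropositionalEquality using (_≡_)
open import Function.Bundles using (_⇔_)

open import Data.Bool using (if_then_else_)
open import Data.Empty using (⊥-elim)
open import Data.Fin using (zero; suc; #_)
open import Data.Fin.Properties using (all?; any?) renaming (_≟_ to _≟ᶠ_)
open import Data.Nat using (ℕ; zero; suc; _+_)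
open import Data.Nat.Properties using (+-comm; +-commutativeSemigroup)
open import Algebra.Properties.CommutativeSemigroup +-commutativeSemigroup using (interchange)
open import Data.Product using (_,_; proj₁; proj₂; swap)
open import Data.Product.Properties using (≡-dec)
open import Data.List using (List; []; _∷_; map; upTo; cartesianProductWith)
open import Data.List.Relation.Unary.Any using (Any; satisfied)
import Data.List.Relation.Unary.Any as Any
open import Data.Vec using (lookup; _∷_; [])
open import Data.Sum using (_⊎_; inj₁; inj₂; [_,_])
open import Function using (_∘_; id)
open import Function.Definitions using (Injective)
open import Function.Bundles using (Inverse; Equivalence; mk⇔; mk↔ₛ′)
open import Function.Construct.Composition using (_⇔-∘_)
open import Function.Construct.Symmetry using (⇔-sym)
open import Relation.Binary.Definitions using (Decidable; DecidableEquality; Symmetric)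
open import Relation.Binary.PropositionalEquality
  using (refl; sym; trans; cong; cong₂; subst; subst₂; _≢_; module ≡-Reasoning)
open import Relation.Nullary using (Dec; yes; no; ¬_; does)
open import Relation.Nullary.Decidable using (map′; _×-dec_; _⊎-dec_; _→-dec_; ¬?; from-yes; does-⇔)
import Relation.Unary as U

_≟ᵥ_ : DecidableEquality V
u i ≟ᵥ u j = map′ (cong u) (λ { refl → refl }) (i ≟ᶠ j)
u i ≟ᵥ v j = no λ ()
v i ≟ᵥ u j = no λ ()
v i ≟ᵥ v j = map′ (cong v) (λ { refl → refl }) (i ≟ᶠ j)

∀ᵥ? : {P : V → Set} → U.Decidable P → Dec (∀ x → P x)
∀ᵥ? P? = map′ (λ (pu , pv) → λ { (u i) → pu i ; (v i) → pv i }) (λ p → p ∘ u , p ∘ v)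
  (all? (P? ∘ u) ×-dec all? (P? ∘ v))

∃ᵥ? : {P : V → Set} → U.Decidable P → Dec (∃ P)
∃ᵥ? P? = map′ [ (λ (i , p) → u i , p) , (λ (i , p) → v i , p) ]
  (λ { (u i , p) → inj₁ (i , p) ; (v i , p) → inj₂ (i , p) })
  (any? (P? ∘ u) ⊎-dec any? (P? ∘ v))

adj? : Decidable Adj
adj? (u i) (u j) with j ≟ᶠ next i | i ≟ᶠ next j
... | yes refl | _        = yes (uu i)
... | no _     | yes refl = yes (uu' j)
... | no j≢i⁺  | no i≢j⁺  = no λ { (uu _) → j≢i⁺ refl ; (uu' _) → i≢j⁺ refl }
adj? (v i) (v j) with j ≟ᶠ next i | i ≟ᶠ next j
... | yes refl | _        = yes (vv i)
... | no _     | yes refl = yes (vv' j)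
... | no j≢i⁺  | no i≢j⁺  = no λ { (vv _) → j≢i⁺ refl ; (vv' _) → i≢j⁺ refl }
adj? (u i) (v j) = map′ (λ { refl → uv i }) (λ { (uv _) → refl }) (i ≟ᶠ j)
adj? (v i) (u j) = map′ (λ { refl → vu i }) (λ { (vu _) → refl }) (i ≟ᶠ j)

Adj-sym : ∀ {x y} → Adj x y → Adj y x
Adj-sym (uu i)  = uu' i
Adj-sym (uu' i) = uu i
Adj-sym (vv i)  = vv' i
Adj-sym (vv' i) = vv i
Adj-sym (uv i)  = vu i
Adj-sym (vu i)  = uv i

⟦_⟧ : Automorphism → V → V
⟦ f ⟧ = Inverse.to (Automorphism.perm f)

⟦_⟧⁻¹ : Automorphism → V → V
⟦ f ⟧⁻¹ = Inverse.from (Automorphism.perm f)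

module _ (f : Automorphism) where
  open Automorphism f

  ⟦⟧-inverseˡ : ∀ x → ⟦ f ⟧ (⟦ f ⟧⁻¹ x) ≡ x
  ⟦⟧-inverseˡ = Inverse.strictlyInverseˡ perm

  ⟦⟧-inverseʳ : ∀ x → ⟦ f ⟧⁻¹ (⟦ f ⟧ x) ≡ x
  ⟦⟧-inverseʳ = Inverse.strictlyInverseʳ perm

  ⟦⟧-injective : Injective _≡_ _≡_ ⟦ f ⟧
  ⟦⟧-injective {x} {y} fx≡fy =
    trans (sym (⟦⟧-inverseʳ x)) (trans (cong ⟦ f ⟧⁻¹ fx≡fy) (⟦⟧-inverseʳ y))

  ⟦⟧-adj : ∀ {x y} → Adj x y → Adj (⟦ f ⟧ x) (⟦ f ⟧ y)
  ⟦⟧-adj = Equivalence.to (preserv _ _)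

  ⟦⟧⁻¹-adj : ∀ {x y} → Adj x y → Adj (⟦ f ⟧⁻¹ x) (⟦ f ⟧⁻¹ y)
  ⟦⟧⁻¹-adj {x} {y} a = Equivalence.from (preserv _ _)
    (subst₂ Adj (sym (⟦⟧-inverseˡ x)) (sym (⟦⟧-inverseˡ y)) a)

mkAutomorphism : (f g : V → V) → (∀ x → f (g x) ≡ x) → (∀ x → g (f x) ≡ x) →
  (∀ {x y} → Adj x y → Adj (f x) (f y)) → (∀ {x y} → Adj x y → Adj (g x) (g y)) →
  Automorphism
mkAutomorphism f g fg gf f-adj g-adj = record
  { perm    = mk↔ₛ′ f g fg gf
  ; preserv = λ x y → mk⇔ f-adj (subst₂ Adj (gf x) (gf y) ∘ g-adj)
  }

_∘ᴬ_ : Automorphism → Automorphism → Automorphism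
f ∘ᴬ g = mkAutomorphism (⟦ f ⟧ ∘ ⟦ g ⟧) (⟦ g ⟧⁻¹ ∘ ⟦ f ⟧⁻¹)
  (λ x → trans (cong ⟦ f ⟧ (⟦⟧-inverseˡ g _)) (⟦⟧-inverseˡ f x))
  (λ x → trans (cong ⟦ g ⟧⁻¹ (⟦⟧-inverseʳ f _)) (⟦⟧-inverseʳ g x))
  (⟦⟧-adj f ∘ ⟦⟧-adj g) (⟦⟧⁻¹-adj g ∘ ⟦⟧⁻¹-adj f)

_⁻¹ᴬ : Automorphism → Automorphism
f ⁻¹ᴬ = mkAutomorphism ⟦ f ⟧⁻¹ ⟦ f ⟧ (⟦⟧-inverseʳ f) (⟦⟧-inverseˡ f) (⟦⟧⁻¹-adj f) (⟦⟧-adj f)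

data Walk : ℕ → V → V → Set where
  []  : ∀ {x} → Walk 0 x x
  _∷_ : ∀ {n x y z} → Adj x y → Walk n y z → Walk (suc n) x z

walk? : ∀ n → Decidable (Walk n)
walk? zero    x y = map′ (λ { refl → [] }) (λ { [] → refl }) (x ≟ᵥ y)
walk? (suc n) x z = map′ (λ (y , a , w) → a ∷ w) (λ { (a ∷ w) → _ , a , w })
  (∃ᵥ? λ y → adj? x y ×-dec walk? n y z)

map-walk : ∀ {n x y} (f : V → V) → (∀ {x y} → Adj x y → Adj (f x) (f y)) →
  Walk n x y → Walk n (f x) (f y)
map-walk f f-adj []      = []
map-walk f f-adj (a ∷ w) = f-adj a ∷ map-walk f f-adj w

walk-preserved : ∀ (f : Automorphism) {n x y} → Walk n x y ⇔ Walk n (⟦ f ⟧ x) (⟦ f ⟧ y)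
walk-preserved f {x = x} {y} = mk⇔ (map-walk ⟦ f ⟧ (⟦⟧-adj f))
  (subst₂ (Walk _) (⟦⟧-inverseʳ f x) (⟦⟧-inverseʳ f y) ∘ map-walk ⟦ f ⟧⁻¹ (⟦⟧⁻¹-adj f))

data Spoke : V → V → Set where
  uv-spoke : ∀ i → Spoke (u i) (v i)
  vu-spoke : ∀ i → Spoke (v i) (u i)

spoke? : Decidable Spoke
spoke? (u i) (v j) = map′ (λ { refl → uv-spoke i }) (λ { (uv-spoke _) → refl }) (i ≟ᶠ j)
spoke? (v i) (u j) = map′ (λ { refl → vu-spoke i }) (λ { (vu-spoke _) → refl }) (i ≟ᶠ j)
spoke? (u i) (u j) = no λ ()
spoke? (v i) (v j) = no λ ()

Spoke-sym : ∀ {x y} → Spoke x y → Spoke y x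
Spoke-sym (uv-spoke i) = vu-spoke i
Spoke-sym (vu-spoke i) = uv-spoke i

-- Spokes are the edges on no pentagon: a rim edge xy closes one, i.e. there is a walk of length 4
-- from x to y, while no closed walk of length 5 uses a spoke.
spoke⇔ : ∀ x y → Spoke x y ⇔ (Adj x y × ¬ Walk 4 x y)
spoke⇔ = from-yes (∀ᵥ? λ x → ∀ᵥ? λ y → equiv? (spoke? x y) (adj? x y ×-dec ¬? (walk? 4 x y)))
  where
  equiv? : ∀ {A B : Set} → Dec A → Dec B → Dec (A ⇔ B)
  equiv? a? b? = map′ (λ (f , g) → mk⇔ f g) (λ e → Equivalence.to e , Equivalence.from e)
    ((a? →-dec b?) ×-dec (b? →-dec a?))

spoke-preserved : ∀ (f : Automorphism) x y → Spoke x y ⇔ Spoke (⟦ f ⟧ x) (⟦ f ⟧ y)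
spoke-preserved f x y = mk⇔
  (λ s → let (a , ¬w) = Equivalence.to (spoke⇔ x y) s in
    Equivalence.from (spoke⇔ _ _) (⟦⟧-adj f a , ¬w ∘ Equivalence.from (walk-preserved f)))
  (λ s → let (a , ¬w) = Equivalence.to (spoke⇔ _ _) s in
    Equivalence.from (spoke⇔ x y)
      (Equivalence.from (Automorphism.preserv f x y) a , ¬w ∘ Equivalence.to (walk-preserved f)))

Edge : Set
Edge = V × V

Pair : Set
Pair = Edge × Edge

mapᴱ : (V → V) → Edge → Edge
mapᴱ f (x , y) = f x , f y

mapᴾ : (V → V) → Pair → Pair
mapᴾ f (e₁ , e₂) = mapᴱ f e₁ , mapᴱ f e₂

_≐_ : Edge → Edge → Set
e ≐ e′ = e ≡ e′ ⊎ e ≡ swap e′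

_∈ᴾ_ : Edge → Pair → Set
e ∈ᴾ (e₁ , e₂) = e₁ ≐ e ⊎ e₂ ≐ e

_≋_ : Pair → Pair → Set
(e₁ , e₂) ≋ (f₁ , f₂) = (e₁ ≐ f₁ × e₂ ≐ f₂) ⊎ (e₁ ≐ f₂ × e₂ ≐ f₁)

Disjoint : Edge → Edge → Set
Disjoint (a , b) (c , d) = a ≢ c × a ≢ d × b ≢ c × b ≢ d

Is2Matching : Pair → Set
Is2Matching ((a , b) , (c , d)) = Adj a b × Adj c d × Disjoint (a , b) (c , d)

≐-sym : ∀ {e e′} → e ≐ e′ → e′ ≐ e
≐-sym (inj₁ refl) = inj₁ refl
≐-sym (inj₂ refl) = inj₂ refl

≐-trans : ∀ {e₁ e₂ e₃} → e₁ ≐ e₂ → e₂ ≐ e₃ → e₁ ≐ e₃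
≐-trans (inj₁ refl) q           = q
≐-trans (inj₂ refl) (inj₁ refl) = inj₂ refl
≐-trans (inj₂ refl) (inj₂ refl) = inj₁ refl

≐-map : ∀ (f : V → V) {e e′} → e ≐ e′ → mapᴱ f e ≐ mapᴱ f e′
≐-map f (inj₁ refl) = inj₁ refl
≐-map f (inj₂ refl) = inj₂ refl

≐-unmap : ∀ {f : V → V} → Injective _≡_ _≡_ f →
  ∀ {e e′} → mapᴱ f e ≐ mapᴱ f e′ → e ≐ e′
≐-unmap f-inj (inj₁ p) = inj₁ (cong₂ _,_ (f-inj (cong proj₁ p)) (f-inj (cong proj₂ p)))
≐-unmap f-inj (inj₂ p) = inj₂ (cong₂ _,_ (f-inj (cong proj₁ p)) (f-inj (cong proj₂ p)))

≐-shared : ∀ {e₁ e₂ e} → e₁ ≐ e → e₂ ≐ e → ¬ Disjoint e₁ e₂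
≐-shared (inj₁ refl) (inj₁ refl) (a≢a , _)     = a≢a refl
≐-shared (inj₁ refl) (inj₂ refl) (_ , a≢a , _) = a≢a refl
≐-shared (inj₂ refl) (inj₁ refl) (_ , b≢b , _) = b≢b refl
≐-shared (inj₂ refl) (inj₂ refl) (a≢a , _)     = a≢a refl

Disjoint-sym : ∀ {e e′} → Disjoint e e′ → Disjoint e′ e
Disjoint-sym (a≢c , a≢d , b≢c , b≢d) = a≢c ∘ sym , b≢c ∘ sym , a≢d ∘ sym , b≢d ∘ sym

Disjoint-map : ∀ (f : V → V) → Injective _≡_ _≡_ f →
  ∀ {e e′} → Disjoint e e′ → Disjoint (mapᴱ f e) (mapᴱ f e′)
Disjoint-map f f-inj (a≢c , a≢d , b≢c , b≢d) =
  a≢c ∘ f-inj , a≢d ∘ f-inj , b≢c ∘ f-inj , b≢d ∘ f-inj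

≋-sym : ∀ {P Q} → P ≋ Q → Q ≋ P
≋-sym (inj₁ (p₁ , p₂)) = inj₁ (≐-sym p₁ , ≐-sym p₂)
≋-sym (inj₂ (p₁ , p₂)) = inj₂ (≐-sym p₂ , ≐-sym p₁)

∈ᴾ-resp-≋ : ∀ {P Q e} → P ≋ Q → e ∈ᴾ P → e ∈ᴾ Q
∈ᴾ-resp-≋ (inj₁ (p₁ , p₂)) (inj₁ h) = inj₁ (≐-trans (≐-sym p₁) h)
∈ᴾ-resp-≋ (inj₁ (p₁ , p₂)) (inj₂ h) = inj₂ (≐-trans (≐-sym p₂) h)
∈ᴾ-resp-≋ (inj₂ (p₁ , p₂)) (inj₁ h) = inj₂ (≐-trans (≐-sym p₁) h)
∈ᴾ-resp-≋ (inj₂ (p₁ , p₂)) (inj₂ h) = inj₁ (≐-trans (≐-sym p₂) h)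

∈ᴾ-map : ∀ (f : V → V) → Injective _≡_ _≡_ f →
  ∀ {e} P → e ∈ᴾ P ⇔ mapᴱ f e ∈ᴾ mapᴾ f P
∈ᴾ-map f f-inj P = mk⇔
  [ inj₁ ∘ ≐-map f , inj₂ ∘ ≐-map f ]
  [ inj₁ ∘ ≐-unmap f-inj , inj₂ ∘ ≐-unmap f-inj ]

disjoint-∈ᴾ⇒≋ : ∀ {e₁ e₂} Q → Disjoint e₁ e₂ → e₁ ∈ᴾ Q → e₂ ∈ᴾ Q → (e₁ , e₂) ≋ Q
disjoint-∈ᴾ⇒≋ Q d (inj₁ p) (inj₁ q) = ⊥-elim (≐-shared (≐-sym p) (≐-sym q) d)
disjoint-∈ᴾ⇒≋ Q d (inj₁ p) (inj₂ q) = inj₁ (≐-sym p , ≐-sym q)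
disjoint-∈ᴾ⇒≋ Q d (inj₂ p) (inj₁ q) = inj₂ (≐-sym p , ≐-sym q)
disjoint-∈ᴾ⇒≋ Q d (inj₂ p) (inj₂ q) = ⊥-elim (≐-shared (≐-sym p) (≐-sym q) d)

edges : Matching 2 → Pair
edges M = Matching.edge M zero , Matching.edge M (suc zero)

─∈⇔∈ᴾ : ∀ (M : Matching 2) {x y} → x ─ y ∈ M ⇔ (x , y) ∈ᴾ edges M
─∈⇔∈ᴾ M = mk⇔ (λ { (zero , p) → inj₁ p ; (suc zero , p) → inj₂ p })
  [ (zero ,_) , (suc zero ,_) ]

edges-is2Matching : ∀ M → Is2Matching (edges M)
edges-is2Matching M =
  Matching.isEdge M zero , Matching.isEdge M (suc zero) , Matching.disjoint M zero (suc zero) λ ()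

toMatching : ∀ P → Is2Matching P → Matching 2
toMatching (e₁ , e₂) (a₁ , a₂ , d) = record { edge = edge ; isEdge = isEdge ; disjoint = disjoint }
  where
  edge : Fin 2 → Edge
  edge zero       = e₁
  edge (suc zero) = e₂
  isEdge : ∀ i → Adj (proj₁ (edge i)) (proj₂ (edge i))
  isEdge zero       = a₁
  isEdge (suc zero) = a₂
  disjoint : ∀ i j → i ≢ j → Disjoint (edge i) (edge j)
  disjoint zero       zero       i≢i = ⊥-elim (i≢i refl)
  disjoint zero       (suc zero) _   = d
  disjoint (suc zero) zero       _   = Disjoint-sym d
  disjoint (suc zero) (suc zero) i≢i = ⊥-elim (i≢i refl)

Automorphic-sym : ∀ {M N : Matching 2} → Automorphic M N → Automorphic N M
Automorphic-sym {M} {N} (f , h) = f ⁻¹ᴬ , λ x y →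
  ⇔-sym (subst₂ (λ x′ y′ → (⟦ f ⟧⁻¹ x ─ ⟦ f ⟧⁻¹ y ∈ M) ⇔ (x′ ─ y′ ∈ N))
    (⟦⟧-inverseˡ f x) (⟦⟧-inverseˡ f y) (h (⟦ f ⟧⁻¹ x) (⟦ f ⟧⁻¹ y)))

Automorphic-trans : ∀ {M N P : Matching 2} → Automorphic M N → Automorphic N P → Automorphic M P
Automorphic-trans (f , h) (g , k) = g ∘ᴬ f , λ x y → k (⟦ f ⟧ x) (⟦ f ⟧ y) ⇔-∘ h x y

automorphic-via-≋ : ∀ {M N : Matching 2} (f : Automorphism) →
  mapᴾ ⟦ f ⟧ (edges M) ≋ edges N → Automorphic M N
automorphic-via-≋ {M} {N} f fM≋N = f , λ x y →
  ⇔-sym (─∈⇔∈ᴾ N) ⇔-∘ (mk⇔ (∈ᴾ-resp-≋ fM≋N) (∈ᴾ-resp-≋ (≋-sym fM≋N))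
    ⇔-∘ (∈ᴾ-map ⟦ f ⟧ (⟦⟧-injective f) (edges M) ⇔-∘ ─∈⇔∈ᴾ M))

automorphic⇒≋ : ∀ {M N : Matching 2} ((f , _) : Automorphic M N) → mapᴾ ⟦ f ⟧ (edges M) ≋ edges N
automorphic⇒≋ {M} {N} (f , h) = disjoint-∈ᴾ⇒≋ (edges N)
  (Disjoint-map ⟦ f ⟧ (⟦⟧-injective f) (Matching.disjoint M zero (suc zero) λ ()))
  (image (zero , inj₁ refl)) (image (suc zero , inj₁ refl))
  where
  image : ∀ {x y} → x ─ y ∈ M → (⟦ f ⟧ x , ⟦ f ⟧ y) ∈ᴾ edges N
  image {x} {y} = Equivalence.to (─∈⇔∈ᴾ N) ∘ Equivalence.to (h x y)

𝟙 : ∀ {A : Set} → Dec A → ℕ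
𝟙 a? = if does a? then 1 else 0

𝟙-⇔ : ∀ {A B : Set} → A ⇔ B → (a? : Dec A) (b? : Dec B) → 𝟙 a? ≡ 𝟙 b?
𝟙-⇔ A⇔B a? b? = cong (λ b → if b then 1 else 0) (does-⇔ A⇔B a? b?)

module _ {R : V → V → Set} (R? : Decidable R) where

  links : Edge → Edge → ℕ
  links (a , b) (c , d) = (𝟙 (R? a c) + 𝟙 (R? a d)) + (𝟙 (R? b c) + 𝟙 (R? b d))

  links-flipˡ : ∀ e₁ e₂ → links (swap e₁) e₂ ≡ links e₁ e₂
  links-flipˡ (a , b) (c , d) = +-comm (𝟙 (R? b c) + 𝟙 (R? b d)) (𝟙 (R? a c) + 𝟙 (R? a d))

  links-flipʳ : ∀ e₁ e₂ → links e₁ (swap e₂) ≡ links e₁ e₂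
  links-flipʳ (a , b) (c , d) =
    cong₂ _+_ (+-comm (𝟙 (R? a d)) (𝟙 (R? a c))) (+-comm (𝟙 (R? b d)) (𝟙 (R? b c)))

  links-exchange : Symmetric R → ∀ e₁ e₂ → links e₂ e₁ ≡ links e₁ e₂
  links-exchange R-sym (a , b) (c , d) = begin
    (𝟙 (R? c a) + 𝟙 (R? c b)) + (𝟙 (R? d a) + 𝟙 (R? d b))
      ≡⟨ cong₂ _+_ (cong₂ _+_ (flip a c) (flip b c)) (cong₂ _+_ (flip a d) (flip b d)) ⟩
    (𝟙 (R? a c) + 𝟙 (R? b c)) + (𝟙 (R? a d) + 𝟙 (R? b d))
      ≡⟨ interchange (𝟙 (R? a c)) (𝟙 (R? b c)) (𝟙 (R? a d)) (𝟙 (R? b d)) ⟩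
    (𝟙 (R? a c) + 𝟙 (R? a d)) + (𝟙 (R? b c) + 𝟙 (R? b d)) ∎
    where
    open ≡-Reasoning
    flip : ∀ x y → 𝟙 (R? y x) ≡ 𝟙 (R? x y)
    flip x y = 𝟙-⇔ (mk⇔ R-sym R-sym) (R? y x) (R? x y)

  links-map : ∀ (f : V → V) → (∀ x y → R x y ⇔ R (f x) (f y)) →
    ∀ e₁ e₂ → links (mapᴱ f e₁) (mapᴱ f e₂) ≡ links e₁ e₂
  links-map f R-pres (a , b) (c , d) =
    cong₂ _+_ (cong₂ _+_ (pres a c) (pres a d)) (cong₂ _+_ (pres b c) (pres b d))
    where
    pres : ∀ x y → 𝟙 (R? (f x) (f y)) ≡ 𝟙 (R? x y)
    pres x y = sym (𝟙-⇔ (R-pres x y) (R? x y) (R? (f x) (f y)))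

Shape : Set
Shape = ℕ × ℕ × ℕ

isSpoke : Edge → ℕ
isSpoke (a , b) = 𝟙 (spoke? a b)

isSpoke-flip : ∀ e → isSpoke (swap e) ≡ isSpoke e
isSpoke-flip (a , b) = 𝟙-⇔ (mk⇔ Spoke-sym Spoke-sym) (spoke? b a) (spoke? a b)

spokes : Pair → ℕ
spokes (e₁ , e₂) = isSpoke e₁ + isSpoke e₂

shape : Pair → Shape
shape P@(e₁ , e₂) = spokes P , links adj? e₁ e₂ , links spoke? e₁ e₂

shape-flipˡ : ∀ e₁ e₂ → shape (swap e₁ , e₂) ≡ shape (e₁ , e₂)
shape-flipˡ e₁ e₂ = cong₂ _,_
  (cong (_+ isSpoke e₂) (isSpoke-flip e₁))
  (cong₂ _,_ (links-flipˡ adj? e₁ e₂) (links-flipˡ spoke? e₁ e₂))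

shape-flipʳ : ∀ e₁ e₂ → shape (e₁ , swap e₂) ≡ shape (e₁ , e₂)
shape-flipʳ e₁ e₂ = cong₂ _,_
  (cong (isSpoke e₁ +_) (isSpoke-flip e₂))
  (cong₂ _,_ (links-flipʳ adj? e₁ e₂) (links-flipʳ spoke? e₁ e₂))

shape-exchange : ∀ e₁ e₂ → shape (e₂ , e₁) ≡ shape (e₁ , e₂)
shape-exchange e₁ e₂ = cong₂ _,_ (+-comm (isSpoke e₂) (isSpoke e₁))
  (cong₂ _,_ (links-exchange adj? Adj-sym e₁ e₂) (links-exchange spoke? Spoke-sym e₁ e₂))

shape-resp-≐ : ∀ {e₁ e₂ f₁ f₂} → e₁ ≐ f₁ → e₂ ≐ f₂ → shape (e₁ , e₂) ≡ shape (f₁ , f₂)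
shape-resp-≐ (inj₁ refl) (inj₁ refl) = refl
shape-resp-≐ {f₁ = f₁} {f₂} (inj₁ refl) (inj₂ refl) = shape-flipʳ f₁ f₂
shape-resp-≐ {f₁ = f₁} {f₂} (inj₂ refl) (inj₁ refl) = shape-flipˡ f₁ f₂
shape-resp-≐ {f₁ = f₁} {f₂} (inj₂ refl) (inj₂ refl) =
  trans (shape-flipˡ f₁ (swap f₂)) (shape-flipʳ f₁ f₂)

shape-resp-≋ : ∀ {P Q} → P ≋ Q → shape P ≡ shape Q
shape-resp-≋ (inj₁ (p₁ , p₂)) = shape-resp-≐ p₁ p₂
shape-resp-≋ {Q = f₁ , f₂} (inj₂ (p₁ , p₂)) = trans (shape-resp-≐ p₁ p₂) (shape-exchange f₁ f₂)

shape-map : ∀ (f : Automorphism) P → shape (mapᴾ ⟦ f ⟧ P) ≡ shape P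
shape-map f ((a , b) , (c , d)) = cong₂ _,_
  (cong₂ _+_ (spoke-pres a b) (spoke-pres c d))
  (cong₂ _,_ (links-map adj? ⟦ f ⟧ (Automorphism.preserv f) (a , b) (c , d))
             (links-map spoke? ⟦ f ⟧ (spoke-preserved f) (a , b) (c , d)))
  where
  spoke-pres : ∀ x y → 𝟙 (spoke? (⟦ f ⟧ x) (⟦ f ⟧ y)) ≡ 𝟙 (spoke? x y)
  spoke-pres x y = sym (𝟙-⇔ (spoke-preserved f x y) (spoke? x y) (spoke? _ _))

lift : (Fin 5 → Fin 5) → V → V
lift s (u i) = u (s i)
lift s (v i) = v (s i)

lift-inverse : ∀ {s t : Fin 5 → Fin 5} → (∀ i → s (t i) ≡ i) → ∀ x → lift s (lift t x) ≡ x
lift-inverse st (u i) = cong u (st i)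
lift-inverse st (v i) = cong v (st i)

lift-adj : ∀ (s : Fin 5 → Fin 5) → (∀ i → s (next i) ≡ next (s i)) →
  ∀ {x y} → Adj x y → Adj (lift s x) (lift s y)
lift-adj s comm (uu i)  = subst (λ j → Adj (u (s i)) (u j)) (sym (comm i)) (uu (s i))
lift-adj s comm (uu' i) = subst (λ j → Adj (u j) (u (s i))) (sym (comm i)) (uu' (s i))
lift-adj s comm (vv i)  = subst (λ j → Adj (v (s i)) (v j)) (sym (comm i)) (vv (s i))
lift-adj s comm (vv' i) = subst (λ j → Adj (v j) (v (s i))) (sym (comm i)) (vv' (s i))
lift-adj s comm (uv i)  = uv (s i)
lift-adj s comm (vu i)  = vu (s i)

lift-adj-reversing : ∀ (s : Fin 5 → Fin 5) → (∀ i → next (s (next i)) ≡ s i) →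
  ∀ {x y} → Adj x y → Adj (lift s x) (lift s y)
lift-adj-reversing s rev (uu i)  = subst (λ j → Adj (u j) (u (s (next i)))) (rev i) (uu' (s (next i)))
lift-adj-reversing s rev (uu' i) = subst (λ j → Adj (u (s (next i))) (u j)) (rev i) (uu (s (next i)))
lift-adj-reversing s rev (vv i)  = subst (λ j → Adj (v j) (v (s (next i)))) (rev i) (vv' (s (next i)))
lift-adj-reversing s rev (vv' i) = subst (λ j → Adj (v (s (next i))) (v j)) (rev i) (vv (s (next i)))
lift-adj-reversing s rev (uv i)  = uv (s i)
lift-adj-reversing s rev (vu i)  = vu (s i)

next⁴ : Fin 5 → Fin 5
next⁴ = next ∘ next ∘ next ∘ next

next-next⁴ : ∀ i → next (next⁴ i) ≡ i
next-next⁴ zero                         = refl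
next-next⁴ (suc zero)                   = refl
next-next⁴ (suc (suc zero))             = refl
next-next⁴ (suc (suc (suc zero)))       = refl
next-next⁴ (suc (suc (suc (suc zero)))) = refl

neg : Fin 5 → Fin 5
neg zero                         = zero
neg (suc zero)                   = # 4
neg (suc (suc zero))             = # 3
neg (suc (suc (suc zero)))       = # 2
neg (suc (suc (suc (suc zero)))) = # 1

neg-involutive : ∀ i → neg (neg i) ≡ i
neg-involutive zero                         = refl
neg-involutive (suc zero)                   = refl
neg-involutive (suc (suc zero))             = refl
neg-involutive (suc (suc (suc zero)))       = refl
neg-involutive (suc (suc (suc (suc zero)))) = refl

neg-reverses : ∀ i → next (neg (next i)) ≡ neg i
neg-reverses zero                         = refl
neg-reverses (suc zero)                   = refl
neg-reverses (suc (suc zero))             = refl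
neg-reverses (suc (suc (suc zero)))       = refl
neg-reverses (suc (suc (suc (suc zero)))) = refl

idᴬ : Automorphism
idᴬ = mkAutomorphism id id (λ _ → refl) (λ _ → refl) id id

rotate : Automorphism
rotate = mkAutomorphism (lift next) (lift next⁴)
  (lift-inverse next-next⁴) (lift-inverse next-next⁴)
  (lift-adj next (λ _ → refl)) (lift-adj next⁴ (λ _ → refl))

reflect : Automorphism
reflect = mkAutomorphism (lift neg) (lift neg)
  (lift-inverse neg-involutive) (lift-inverse neg-involutive)
  (lift-adj-reversing neg neg-reverses) (lift-adj-reversing neg neg-reverses)

otherSide : V → V
otherSide (u i) = v i
otherSide (v i) = u i

otherSide-involutive : ∀ x → otherSide (otherSide x) ≡ x
otherSide-involutive (u i) = refl
otherSide-involutive (v i) = refl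

otherSide-adj : ∀ {x y} → Adj x y → Adj (otherSide x) (otherSide y)
otherSide-adj (uu i)  = vv i
otherSide-adj (uu' i) = vv' i
otherSide-adj (vv i)  = uu i
otherSide-adj (vv' i) = uu' i
otherSide-adj (uv i)  = vu i
otherSide-adj (vu i)  = uv i

swapSides : Automorphism
swapSides = mkAutomorphism otherSide otherSide
  otherSide-involutive otherSide-involutive otherSide-adj otherSide-adj

rotation : ℕ → Automorphism
rotation zero    = idᴬ
rotation (suc k) = rotate ∘ᴬ rotation k

symmetries : List Automorphism
symmetries = cartesianProductWith _∘ᴬ_ (map rotation (upTo 5))
  (idᴬ ∷ reflect ∷ swapSides ∷ reflect ∘ᴬ swapSides ∷ [])

_≐?_ : Decidable _≐_
e ≐? e′ = (≡-dec _≟ᵥ_ _≟ᵥ_ e e′) ⊎-dec (≡-dec _≟ᵥ_ _≟ᵥ_ e (swap e′))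

_≋?_ : Decidable _≋_
(e₁ , e₂) ≋? (f₁ , f₂) = ((e₁ ≐? f₁) ×-dec (e₂ ≐? f₂)) ⊎-dec ((e₁ ≐? f₂) ×-dec (e₂ ≐? f₁))

is2Matching? : U.Decidable Is2Matching
is2Matching? ((a , b) , (c , d)) = adj? a b ×-dec adj? c d ×-dec
  ¬? (a ≟ᵥ c) ×-dec ¬? (a ≟ᵥ d) ×-dec ¬? (b ≟ᵥ c) ×-dec ¬? (b ≟ᵥ d)

classify : Shape → Fin 8
classify (2 , 2 , _) = # 0
classify (2 , _ , _) = # 1
classify (0 , 2 , _) = # 2
classify (0 , 1 , 1) = # 3
classify (0 , 1 , _) = # 4
classify (0 , _ , _) = # 5
classify (1 , 1 , _) = # 6
classify _           = # 7

type : Pair → Fin 8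
type = classify ∘ shape

representative : Fin 8 → Pair
representative = lookup
  ( ((u (# 0) , v (# 0)) , (u (# 1) , v (# 1)))
  ∷ ((u (# 0) , v (# 0)) , (u (# 2) , v (# 2)))
  ∷ ((u (# 0) , u (# 1)) , (v (# 0) , v (# 1)))
  ∷ ((u (# 0) , u (# 1)) , (v (# 1) , v (# 2)))
  ∷ ((u (# 0) , u (# 1)) , (u (# 2) , u (# 3)))
  ∷ ((u (# 0) , u (# 1)) , (v (# 2) , v (# 3)))
  ∷ ((u (# 0) , v (# 0)) , (u (# 1) , u (# 2)))
  ∷ ((u (# 0) , v (# 0)) , (u (# 2) , u (# 3)))
  ∷ [] )

representative-is2Matching : ∀ k → Is2Matching (representative k)
representative-is2Matching = from-yes (all? (is2Matching? ∘ representative))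

type-representative : ∀ k → type (representative k) ≡ k
type-representative = from-yes (all? λ k → type (representative k) ≟ᶠ k)

-- Opaque, so that its uses do not unfold and re-run the exhaustive check.
opaque
  normalising-symmetry : ∀ P → Is2Matching P →
    Any (λ g → mapᴾ ⟦ g ⟧ P ≋ representative (type P)) symmetries
  normalising-symmetry ((a , b) , (c , d)) = from-yes
    (∀ᵥ? λ a → ∀ᵥ? λ b → ∀ᵥ? λ c → ∀ᵥ? λ d → let P = (a , b) , (c , d) in
      is2Matching? P →-dec Any.any? (λ g → mapᴾ ⟦ g ⟧ P ≋? representative (type P)) symmetries)
    a b c d

typeOf : Matching 2 → Fin 8
typeOf = type ∘ edges

representativeMatching : Fin 8 → Matching 2
representativeMatching k = toMatching (representative k) (representative-is2Matching k)

automorphic-to-representative : ∀ M → Automorphic M (representativeMatching (typeOf M))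
automorphic-to-representative M =
  let g , gM≋ = satisfied (normalising-symmetry (edges M) (edges-is2Matching M))
  in automorphic-via-≋ {M} {representativeMatching (typeOf M)} g gM≋

same-type⇒automorphic : ∀ M N → typeOf M ≡ typeOf N → Automorphic M N
same-type⇒automorphic M N τM≡τN = Automorphic-trans {M} {R} {N}
  (automorphic-to-representative M)
  (Automorphic-sym {N} {R}
    (subst (Automorphic N ∘ representativeMatching) (sym τM≡τN) (automorphic-to-representative N)))
  where R = representativeMatching (typeOf M)

automorphic⇒same-type : ∀ M N → Automorphic M N → typeOf M ≡ typeOf N
automorphic⇒same-type M N M≅N@(f , _) = cong classify (begin
  shape (edges M)              ≡⟨ shape-map f (edges M) ⟨
  shape (mapᴾ ⟦ f ⟧ (edges M)) ≡⟨ shape-resp-≋ (automorphic⇒≋ {M} {N} M≅N) ⟩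
  shape (edges N)              ∎)
  where open ≡-Reasoning

lemma5 : Σ (Matching 2 → Fin 8) λ τ →
    (∀ j → ∃ λ M → τ M ≡ j) × (∀ M N → (τ M ≡ τ N) ⇔ Automorphic M N)
lemma5 = typeOf
  , (λ k → representativeMatching k , type-representative k)
  , λ M N → mk⇔ (same-type⇒automorphic M N) (automorphic⇒same-type M N)
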